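{- Let $n\geq t\geq 1$ be integers. The maximum number of descents that a $t$-sorted permutation in $S_n$ can have is $\left\lfloor\frac{n-t}{2}\right\rfloor$; that is, $\max\{\operatorname{des}(s^t(\mu)):\mu\in S_n\}=\left\lfloor\frac{n-t}{2}\right\rfloor$.
   Context: A permutation is a permutation of a finite set of positive integers written in one-line notation; $S_n$ is the set of permutations of $[n]=\{1,\dots,n\}$. West's stack-sorting map $s$ is defined as follows: given an input permutation $\pi=\pi_1\cdots\pi_n$, process it with an initially empty vertical stack; at each step, if the stack is empty or the next entry of the input is smaller than the entry at the top of the stack, push the next input entry onto the stack; otherwise pop the top entry of the stack and append it to the end of the output. When the output has length $n$, this output is $s(\pi)$. (E.g. $s(4162)=1426$.) $s^t$ denotes the $t$-fold composition of $s$. A permutation is $t$-sorted if it equals $s^t(\mu)$ for some permutation $\mu$. A descent of $\pi=\pi_1\cdots\pi_n$ is an index $i\in[n-1]$ with $\pi_i>\pi_{i+1}$, and $\operatorname{des}(\pi)$ is the number of descents. -}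

module Defs where

open import Data.Nat using (ℕ; zero; suc; _+_; _<_; _<?_; _∸_)
open import Data.List using (List; []; _∷_; _++_; map; upTo)
open import Data.Product using (_×_; _,_; proj₁; proj₂)
open import Data.Bool using (Bool; true; false; if_then_else_)
open import Relation.Nullary.Decidable using (⌊_⌋)
open import Relation.Binary.PropositionalEquality using (_≡_)
open import Data.List.Relation.Binary.Permutation.Propositional using (_↭_)
open import Function using (_∘_)

range1 : ℕ → List ℕ
range1 n = map suc (upTo n)

-- μ ∈ S_n : μ is a rearrangement of 1..n (one-line notation)
IsPerm : ℕ → List ℕ → Set
IsPerm n μ = μ ↭ range1 n

-- Pop entries from the stack (head = top) while the next input entry x
-- is not smaller than the top; returns (popped entries in output order, remaining stack).
popWhile : ℕ → List ℕ → List ℕ × List ℕ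
popWhile x [] = ([] , [])
popWhile x (y ∷ ys) with ⌊ x <? y ⌋
... | true  = ([] , y ∷ ys)
... | false = let r = popWhile x ys in (y ∷ proj₁ r , proj₂ r)

stackRun : List ℕ → List ℕ → List ℕ
stackRun st [] = st
stackRun st (x ∷ xs) = let r = popWhile x st in proj₁ r ++ stackRun (x ∷ proj₂ r) xs

s : List ℕ → List ℕ
s = stackRun []

s^ : ℕ → List ℕ → List ℕ
s^ zero π = π
s^ (suc t) π = s (s^ t π)

des : List ℕ → ℕ
des [] = 0
des (x ∷ []) = 0
des (x ∷ y ∷ ys) = (if ⌊ y <? x ⌋ then 1 else 0) + des (y ∷ ys)

module Submission where

-- Upper bound.  (1) One pass: 2·des(s π) ≤ |π| − 1.  A descent of the
-- output needs an entry pushed after the larger entry was popped, and the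
-- entry that triggered that pop lies in between; this charging argument
-- is the invariant 'des-run-bound', proved by induction on the input with
-- an ascending stack.  (2) After r passes, s^r μ = A ++ L where L is an
-- ascending tail of length r dominating every entry of A: the next pass
-- acts on A alone (its tail L is pushed and popped unchanged), and s(A)
-- ends with its maximum, which joins the tail.  Hence
-- des(s^t μ) = des(s A) for a front A of length n − t + 1, and (1) applies.
--
-- The permutation
--   k+1, …, k+t,  k+t+1, 1, k+t+2, 2, …, 2k+t, k,  2k+t+1, …, n
-- with k = ⌊(n − t)/2⌋ loses one entry of its initial increasing run to
-- its final increasing run per pass, so s^t of it is a zigzag with k descents.

open import Defs
open import Data.Nat using (ℕ; zero; suc; _+_; _*_; _≤_; _<_; _<?_; _∸_; _/_; _%_; z≤n; s≤s)
open import Data.Nat.Properties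
open import Data.Nat.DivMod using (m*n/n≡m; /-monoˡ-≤; m≡m%n+[m/n]*n)
open import Data.Nat.Solver using (module +-*-Solver)
open import Data.List using (List; []; _∷_; _++_; length; [_]; upTo; applyUpTo)
open import Data.List.Properties using (++-assoc; ++-identityʳ; length-++; length-map; length-upTo; map-applyUpTo)
open import Data.List.Relation.Unary.All as All using (All; []; _∷_)
open import Data.List.Relation.Unary.All.Properties using (++⁺; ++⁻ʳ)
open import Data.List.Relation.Unary.Linked as Linked using (Linked; []; [-]; _∷_)
open import Data.List.Relation.Binary.Permutation.Propositional using (_↭_; prep; swap; ↭-refl; ↭-sym; ↭-trans; ↭-reflexive; module PermutationReasoning)
open import Data.List.Relation.Binary.Permutation.Propositional.Properties using (shift; shifts; ↭-length; All-resp-↭) renaming (++⁺ˡ to ↭-++⁺ˡ; ++⁺ʳ to ↭-++⁺ʳ)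
open import Data.Product using (_×_; Σ; _,_; proj₁; proj₂)
open import Data.Unit using (⊤; tt)
open import Data.Empty using (⊥-elim)
open import Data.Bool using (if_then_else_)
open import Function using (id; _∘′_)
open import Relation.Nullary using (yes; no)
open import Relation.Nullary.Decidable using (⌊_⌋)
open import Relation.Binary.PropositionalEquality hiding ([_])

-- The descent indicator; by definition des (x ∷ y ∷ ys) ≡ descent x y + des (y ∷ ys).
descent : ℕ → ℕ → ℕ
descent x y = if ⌊ y <? x ⌋ then 1 else 0

descent-≤ : ∀ {x y} → x ≤ y → descent x y ≡ 0
descent-≤ {x} {y} x≤y with y <? x
... | yes y<x = ⊥-elim (<⇒≱ y<x x≤y)
... | no _    = refl

descent-< : ∀ {x y} → y < x → descent x y ≡ 1
descent-< {x} {y} y<x with y <? x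
... | yes _   = refl
... | no y≮x  = ⊥-elim (y≮x y<x)

descent≤1 : ∀ x y → descent x y ≤ 1
descent≤1 x y with y <? x
... | yes _ = ≤-refl
... | no _  = z≤n

-- Weakly increasing lists; the stack, read from its top, is always one.
Ascending : List ℕ → Set
Ascending = Linked _≤_

_≤*_ : ℕ → List ℕ → Set
x ≤* []      = ⊤
x ≤* (y ∷ _) = x ≤ y

∷-ascending : ∀ {x xs} → x ≤* xs → Ascending xs → Ascending (x ∷ xs)
∷-ascending {xs = []}    _   _   = [-]
∷-ascending {xs = _ ∷ _} x≤y asc = x≤y ∷ asc

++-ascendingˡ : ∀ xs {ys} → Ascending (xs ++ ys) → Ascending xs
++-ascendingˡ []           _           = []
++-ascendingˡ (x ∷ [])     _           = [-]
++-ascendingˡ (x ∷ y ∷ xs) (x≤y ∷ asc) = x≤y ∷ ++-ascendingˡ (y ∷ xs) asc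

++-ascendingʳ : ∀ xs {ys} → Ascending (xs ++ ys) → Ascending ys
++-ascendingʳ []       asc = asc
++-ascendingʳ (x ∷ xs) asc = ++-ascendingʳ xs (Linked.tail asc)

ascending-des : ∀ {xs} → Ascending xs → des xs ≡ 0
ascending-des []          = refl
ascending-des [-]         = refl
ascending-des (x≤y ∷ asc) = cong₂ _+_ (descent-≤ x≤y) (ascending-des asc)

lastOf : ℕ → List ℕ → ℕ
lastOf h []      = h
lastOf h (p ∷ P) = lastOf p P

lastOf-≤ : ∀ {x} h P → All (_≤ x) (h ∷ P) → lastOf h P ≤ x
lastOf-≤ h []      (h≤x ∷ _) = h≤x
lastOf-≤ h (p ∷ P) (_ ∷ P≤x) = lastOf-≤ p P P≤x

des-ascending-prefix : ∀ h P R → Ascending (h ∷ P) → des ((h ∷ P) ++ R) ≡ des (lastOf h P ∷ R)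
des-ascending-prefix h []      R _           = refl
des-ascending-prefix h (p ∷ P) R (h≤p ∷ asc) = cong₂ _+_ (descent-≤ h≤p) (des-ascending-prefix p P R asc)

des-split : ∀ Z m L → des (Z ++ m ∷ L) ≡ des (Z ++ [ m ]) + des (m ∷ L)
des-split []           m L = refl
des-split (z ∷ [])     m L = cong (_+ des (m ∷ L)) (sym (+-identityʳ (descent z m)))
des-split (z ∷ z′ ∷ Z) m L =
  trans (cong (descent z z′ +_) (des-split (z′ ∷ Z) m L)) (sym (+-assoc (descent z z′) _ _))

popped kept : ℕ → List ℕ → List ℕ
popped x st = proj₁ (popWhile x st)
kept   x st = proj₂ (popWhile x st)

popWhile-spec : ∀ x st → (st ≡ popped x st ++ kept x st) × All (_≤ x) (popped x st) × suc x ≤* kept x st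
popWhile-spec x []       = refl , [] , tt
popWhile-spec x (y ∷ ys) with x <? y
... | yes x<y = refl , [] , x<y
... | no x≮y with popWhile-spec x ys
...   | split , below , above = cong (y ∷_) split , ≮⇒≥ x≮y ∷ below , above

popWhile-all : ∀ x st → All (_≤ x) st → popWhile x st ≡ (st , [])
popWhile-all x []       _             = refl
popWhile-all x (y ∷ ys) (y≤x ∷ ys≤x) with x <? y
... | yes x<y = ⊥-elim (<⇒≱ x<y y≤x)
... | no _ rewrite popWhile-all x ys ys≤x = refl

run-below : ∀ st x X → All (_≤ x) st → stackRun st (x ∷ X) ≡ st ++ stackRun [ x ] X
run-below st x X st≤x rewrite popWhile-all x st st≤x = refl

run-push : ∀ {h x} T xs → x < h → stackRun (h ∷ T) (x ∷ xs) ≡ stackRun (x ∷ h ∷ T) xs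
run-push {h} {x} T xs x<h with x <? h
... | yes _   = refl
... | no x≮h  = ⊥-elim (x≮h x<h)

run-ascending : ∀ st L → All (_≤* L) st → Ascending L → stackRun st L ≡ st ++ L
run-ascending st []      _     _   = sym (++-identityʳ st)
run-ascending st (l ∷ L) st≤l asc =
  trans (run-below st l L st≤l) (cong (st ++_) (run-ascending [ l ] L (head-≤ asc ∷ []) (Linked.tail asc)))
  where
    head-≤ : ∀ {L} → Ascending (l ∷ L) → l ≤* L
    head-≤ [-]       = tt
    head-≤ (l≤ ∷ _)  = l≤

run-↭ : ∀ st xs → stackRun st xs ↭ st ++ xs
run-↭ st []       = ↭-reflexive (sym (++-identityʳ st))
run-↭ st (x ∷ xs) = begin
  P ++ stackRun (x ∷ S) xs  ↭⟨ ↭-++⁺ˡ P (run-↭ (x ∷ S) xs) ⟩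
  P ++ (x ∷ S ++ xs)        ↭⟨ ↭-++⁺ˡ P (↭-sym (shift x S xs)) ⟩
  P ++ (S ++ x ∷ xs)        ≡⟨ sym (++-assoc P S (x ∷ xs)) ⟩
  (P ++ S) ++ x ∷ xs        ≡⟨ cong (_++ x ∷ xs) (sym (proj₁ (popWhile-spec x st))) ⟩
  st ++ x ∷ xs              ∎
  where
    open PermutationReasoning
    P = popped x st
    S = kept x st

length-s^ : ∀ r μ → length (s^ r μ) ≡ length μ
length-s^ zero    μ = refl
length-s^ (suc r) μ = trans (↭-length (run-↭ [] (s^ r μ))) (length-s^ r μ)

pop-ascending : ∀ {h x} T → h ≤ x → Ascending (h ∷ T) →
  Ascending (h ∷ popped x T) × All (_≤ x) (h ∷ popped x T) × Ascending (x ∷ kept x T)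
pop-ascending {h} {x} T h≤x asc = ++-ascendingˡ (h ∷ P) asc′ , h≤x ∷ P≤x , ∷-ascending (weaken S>x) (++-ascendingʳ (h ∷ P) asc′)
  where
    P = popped x T
    S = kept x T
    spec = popWhile-spec x T
    P≤x = proj₁ (proj₂ spec)
    S>x = proj₂ (proj₂ spec)
    asc′ : Ascending (h ∷ P ++ S)
    asc′ = subst (λ T → Ascending (h ∷ T)) (proj₁ spec) asc
    weaken : ∀ {S} → suc x ≤* S → x ≤* S
    weaken {[]}    _   = tt
    weaken {_ ∷ _} x<y = <⇒≤ x<y

-- Arithmetic of one pop step: a 0/1 descent added to a paid-for count.
indicator-bound : ∀ {i d m} → i ≤ 1 → d + d ≤ m → (i + d) + (i + d) ≤ suc (i + m)
indicator-bound z≤n h = m≤n⇒m≤1+n h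
indicator-bound {d = d} {m} (s≤s z≤n) h = s≤s (subst (_≤ suc m) (sym (+-suc d d)) (s≤s h))

mutual
  des-run-bound : ∀ a h T xs → Ascending (h ∷ T) →
    des (a ∷ stackRun (h ∷ T) xs) + des (a ∷ stackRun (h ∷ T) xs) ≤ suc (descent a h + length xs)
  des-run-bound a h T [] asc rewrite ascending-des asc = indicator-bound (descent≤1 a h) z≤n
  des-run-bound a h T (x ∷ xs) asc with x <? h
  ... | yes x<h = ≤-trans (des-run-bound a x (h ∷ T) xs (<⇒≤ x<h ∷ asc))
                          (s≤s (≤-trans (+-monoˡ-≤ (length xs) (descent≤1 a x)) (m≤n+m (suc (length xs)) (descent a h))))
  ... | no x≮h  = indicator-bound (descent≤1 a h) (des-after-pop h x T xs (≮⇒≥ x≮h) asc)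

  -- When x pops the block h ∷ P, the output from h on has as many descents
  -- as the output from the last popped entry on, which is at most x; so
  -- they are paid for by the input after x.
  des-after-pop : ∀ h x T xs → h ≤ x → Ascending (h ∷ T) →
    des ((h ∷ popped x T) ++ stackRun (x ∷ kept x T) xs) + des ((h ∷ popped x T) ++ stackRun (x ∷ kept x T) xs)
      ≤ suc (length xs)
  des-after-pop h x T xs h≤x asc with pop-ascending T h≤x asc
  ... | ascP , P≤x , ascS rewrite des-ascending-prefix h (popped x T) (stackRun (x ∷ kept x T) xs) ascP =
    subst (λ i → d + d ≤ suc (i + length xs)) (descent-≤ (lastOf-≤ h (popped x T) P≤x))
          (des-run-bound ℓ x (kept x T) xs ascS)
    where
      ℓ = lastOf h (popped x T)
      d = des (ℓ ∷ stackRun (x ∷ kept x T) xs)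

-- The same count for a run whose output starts the list; now the entries
-- below the top of the initial stack also pay.
des-run-bound₀ : ∀ h T xs → Ascending (h ∷ T) →
  des (stackRun (h ∷ T) xs) + des (stackRun (h ∷ T) xs) ≤ length T + length xs
des-run-bound₀ h T [] asc rewrite ascending-des asc = z≤n
des-run-bound₀ h T (x ∷ xs) asc with x <? h
... | yes x<h = ≤-trans (des-run-bound₀ x (h ∷ T) xs (<⇒≤ x<h ∷ asc)) (≤-reflexive (sym (+-suc (length T) (length xs))))
... | no x≮h  = ≤-trans (des-after-pop h x T xs (≮⇒≥ x≮h) asc) (m≤n+m (suc (length xs)) (length T))

des-s : ∀ x xs → des (s (x ∷ xs)) + des (s (x ∷ xs)) ≤ length xs
des-s x xs = des-run-bound₀ x [] xs [-]

record EndsWithMax (out st : List ℕ) : Set where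
  constructor endsWith
  field
    body    : List ℕ
    maximum : ℕ
    shape   : out ≡ body ++ [ maximum ]
    body≤   : All (_≤ maximum) body
    stack≤  : All (_≤ maximum) st

ascending-ends-with-max : ∀ h T → Ascending (h ∷ T) → EndsWithMax (h ∷ T) (h ∷ T)
ascending-ends-with-max h []       [-]         = endsWith [] h refl [] (≤-refl ∷ [])
ascending-ends-with-max h (h′ ∷ T) (h≤h′ ∷ asc) with ascending-ends-with-max h′ T asc
... | endsWith Z m e Z≤m (h′≤m ∷ T≤m) =
  endsWith (h ∷ Z) m (cong (h ∷_) e) (≤-trans h≤h′ h′≤m ∷ Z≤m) (≤-trans h≤h′ h′≤m ∷ h′≤m ∷ T≤m)

run-ends-with-max : ∀ h T xs → Ascending (h ∷ T) → EndsWithMax (stackRun (h ∷ T) xs) (h ∷ T)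
run-ends-with-max h T [] asc = ascending-ends-with-max h T asc
run-ends-with-max h T (x ∷ xs) asc with x <? h
... | yes x<h with run-ends-with-max x (h ∷ T) xs (<⇒≤ x<h ∷ asc)
...   | endsWith Z m e Z≤m (_ ∷ hT≤m) = endsWith Z m e Z≤m hT≤m
run-ends-with-max h T (x ∷ xs) asc | no x≮h with pop-ascending T (≮⇒≥ x≮h) asc
... | _ , hP≤x , ascS with run-ends-with-max x (kept x T) xs ascS
...   | endsWith Z m e Z≤m (x≤m ∷ S≤m) =
  endsWith ((h ∷ popped x T) ++ Z) m
           (trans (cong ((h ∷ popped x T) ++_) e) (sym (++-assoc (h ∷ popped x T) Z [ m ])))
           (++⁺ hP≤m Z≤m)
           (All.head hP≤m ∷ subst (All (_≤ m)) (sym (proj₁ (popWhile-spec x T))) (++⁺ (All.tail hP≤m) S≤m))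
  where
    hP≤m : All (_≤ m) (h ∷ popped x T)
    hP≤m = All.map (λ y≤x → ≤-trans y≤x x≤m) hP≤x

run-++-tail : ∀ st A L → All (_≤* L) st → All (_≤* L) A → Ascending L → stackRun st (A ++ L) ≡ stackRun st A ++ L
run-++-tail st []      L st≤L _            asc = run-ascending st L st≤L asc
run-++-tail st (x ∷ A) L st≤L (x≤L ∷ A≤L) asc =
  trans (cong (popped x st ++_) (run-++-tail (x ∷ kept x st) A L (x≤L ∷ S≤L) A≤L asc))
        (sym (++-assoc (popped x st) _ L))
  where
    S≤L : All (_≤* L) (kept x st)
    S≤L = ++⁻ʳ (popped x st) (subst (All (_≤* L)) (proj₁ (popWhile-spec x st)) st≤L)

record PassOverTail (a : ℕ) (A L : List ℕ) : Set where
  constructor passOverTail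
  field
    body        : List ℕ
    maximum     : ℕ
    front-shape : s (a ∷ A) ≡ body ++ [ maximum ]
    whole-shape : s ((a ∷ A) ++ L) ≡ body ++ maximum ∷ L
    body≤       : All (_≤ maximum) body
    tail-asc    : Ascending (maximum ∷ L)

pass-over-tail : ∀ a A L → All (_≤* L) (a ∷ A) → Ascending L → PassOverTail a A L
pass-over-tail a A L aA≤L asc with run-ends-with-max a [] A [-]
... | endsWith Z m e Z≤m _ = passOverTail Z m e whole Z≤m (∷-ascending m≤L asc)
  where
    whole : s ((a ∷ A) ++ L) ≡ Z ++ m ∷ L
    whole = trans (run-++-tail [] (a ∷ A) L [] aA≤L asc) (trans (cong (_++ L) e) (++-assoc Z [ m ] L))
    m≤L : m ≤* L
    m≤L = All.head (++⁻ʳ Z (subst (All (_≤* L)) e (All-resp-↭ (↭-sym (run-↭ [] (a ∷ A))) aA≤L)))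

record SortedTail (r : ℕ) (π : List ℕ) : Set where
  constructor sortedTail
  field
    front       : List ℕ
    tail        : List ℕ
    split       : π ≡ front ++ tail
    tail-length : length tail ≡ r
    tail-asc    : Ascending tail
    front≤tail  : All (_≤* tail) front

  front-length : length front + r ≡ length π
  front-length = trans (cong (length front +_) (sym tail-length))
                       (trans (sym (length-++ front)) (cong length (sym split)))

-- r passes establish the invariant with a tail of length r, as long as
-- r ≤ |μ| (a nonempty front is needed to extend the tail).
sorted-tail : ∀ r μ → r ≤ length μ → SortedTail r (s^ r μ)
sorted-tail zero μ _ = sortedTail μ [] (sym (++-identityʳ μ)) refl [] (All.universal (λ _ → tt) μ)
sorted-tail (suc r) μ r<μ with sorted-tail r μ (≤-trans (n≤1+n r) r<μ)
... | σ@(sortedTail [] _ _ _ _ _) =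
  ⊥-elim (<⇒≱ r<μ (≤-reflexive (trans (sym (length-s^ r μ)) (sym (SortedTail.front-length σ)))))
... | sortedTail (a ∷ A) L e lL ascL A≤L with pass-over-tail a A L A≤L ascL
...   | passOverTail Z m _ whole Z≤m ascmL = sortedTail Z (m ∷ L) (trans (cong s e) whole) (cong suc lL) ascmL Z≤m

half : ∀ d m → d + d ≤ m → d ≤ m / 2
half d m h = ≤-trans (≤-reflexive (sym (m*n/n≡m d 2))) (/-monoˡ-≤ 2 (subst (_≤ m) double h))
  where
    double : d + d ≡ d * 2
    double = trans (cong (d +_) (sym (+-identityʳ d))) (sym (*-comm d 2))

perm-length : ∀ n μ → IsPerm n μ → length μ ≡ n
perm-length n μ p = trans (↭-length p) (trans (length-map suc (upTo n)) (length-upTo n))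

upper-bound : ∀ n t μ → IsPerm n μ → suc t ≤ n → des (s^ (suc t) μ) ≤ (n ∸ suc t) / 2
upper-bound n t μ perm t<n with sorted-tail t μ (≤-trans (n≤1+n t) (≤-trans t<n (≤-reflexive (sym (perm-length n μ perm)))))
... | σ@(sortedTail [] _ _ _ _ _) =
  ⊥-elim (<⇒≱ t<n (≤-reflexive (trans (sym (perm-length n μ perm)) (trans (sym (length-s^ t μ)) (sym (SortedTail.front-length σ))))))
... | σ@(sortedTail (a ∷ A) L e _ ascL A≤L) with pass-over-tail a A L A≤L ascL
...   | passOverTail Z m front whole _ ascmL =
  subst (_≤ (n ∸ suc t) / 2) (sym same-des) (half _ _ (subst (des (s (a ∷ A)) + des (s (a ∷ A)) ≤_) length-A (des-s a A)))
  where
    open ≡-Reasoning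
    same-des : des (s^ (suc t) μ) ≡ des (s (a ∷ A))
    same-des = begin
      des (s (s^ t μ))                ≡⟨ cong (des ∘′ s) e ⟩
      des (s ((a ∷ A) ++ L))          ≡⟨ cong des whole ⟩
      des (Z ++ m ∷ L)                ≡⟨ des-split Z m L ⟩
      des (Z ++ [ m ]) + des (m ∷ L)  ≡⟨ cong₂ _+_ (cong des (sym front)) (ascending-des ascmL) ⟩
      des (s (a ∷ A)) + 0             ≡⟨ +-identityʳ _ ⟩
      des (s (a ∷ A))                 ∎
    length-A : length A ≡ n ∸ suc t
    length-A = begin
      length A                          ≡⟨ sym (m+n∸n≡m (length A) (suc t)) ⟩
      (length A + suc t) ∸ suc t        ≡⟨ cong (_∸ suc t) (+-suc (length A) t) ⟩
      (suc (length A) + t) ∸ suc t      ≡⟨ cong (_∸ suc t) (SortedTail.front-length σ) ⟩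
      length (s^ t μ) ∸ suc t           ≡⟨ cong (_∸ suc t) (trans (length-s^ t μ) (perm-length n μ perm)) ⟩
      n ∸ suc t                         ∎

interval : ℕ → ℕ → List ℕ
interval a zero    = []
interval a (suc n) = a ∷ interval (suc a) n

zigzag : ℕ → ℕ → ℕ → List ℕ
zigzag b d zero    = []
zigzag b d (suc k) = b ∷ d ∷ zigzag (suc b) (suc d) k

interval-ascending : ∀ a n → Ascending (interval a n)
interval-ascending a zero          = []
interval-ascending a (suc zero)    = [-]
interval-ascending a (suc (suc n)) = n≤1+n a ∷ interval-ascending (suc a) (suc n)

≤*-interval : ∀ {x} a n → x ≤ a → x ≤* interval a n
≤*-interval a zero    _   = tt
≤*-interval a (suc n) x≤a = x≤a

interval-++ : ∀ a i j → interval a (i + j) ≡ interval a i ++ interval (a + i) j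
interval-++ a zero    j = cong (λ b → interval b j) (sym (+-identityʳ a))
interval-++ a (suc i) j =
  cong (a ∷_) (trans (interval-++ (suc a) i j) (cong (λ b → interval (suc a) i ++ interval b j) (sym (+-suc a i))))

applyUpTo-shift : ∀ (f : ℕ → ℕ) a n → (∀ i → f i ≡ a + i) → applyUpTo f n ≡ interval a n
applyUpTo-shift f a zero    _     = refl
applyUpTo-shift f a (suc n) f≡a+ =
  cong₂ _∷_ (trans (f≡a+ 0) (+-identityʳ a)) (applyUpTo-shift (λ i → f (suc i)) (suc a) n (λ i → trans (f≡a+ (suc i)) (+-suc a i)))

range1-interval : ∀ n → range1 n ≡ interval 1 n
range1-interval n = trans (map-applyUpTo id suc n) (applyUpTo-shift suc 1 n (λ _ → refl))

candidate : ℕ → ℕ → ℕ → ℕ → List ℕ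
candidate a c k z = interval a c ++ zigzag (a + c) 1 k ++ interval (a + c + k) z

run-interval : ∀ y j X → stackRun [ y ] (interval (suc y) j ++ X) ≡ interval y j ++ stackRun [ y + j ] X
run-interval y zero    X = cong (λ v → stackRun [ v ] X) (sym (+-identityʳ y))
run-interval y (suc j) X =
  trans (run-below [ y ] (suc y) (interval (suc (suc y)) j ++ X) (n≤1+n y ∷ []))
        (cong (y ∷_) (trans (run-interval (suc y) j X)
                            (cong (λ v → interval (suc y) j ++ stackRun [ v ] X) (sym (+-suc y j)))))

-- Each pair (b+1, d+1) of a zigzag pops the whole stack and is pushed, so
-- the zigzag is output with every pair reversed.
zigzag-pass : ∀ {st b d} k z → All (_≤ suc b) st → d < b →
  stackRun st (zigzag (suc b) (suc d) k ++ interval (suc b + k) z) ≡ st ++ zigzag (suc d) (suc b) k ++ interval (suc b + k) z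
zigzag-pass {st} {b} zero z st≤ _ rewrite +-identityʳ b =
  run-ascending st (interval (suc b) z) (All.map (≤*-interval (suc b) z) st≤) (interval-ascending (suc b) z)
zigzag-pass {st} {b} {d} (suc k) z st≤ d<b rewrite +-suc b k =
  trans (run-below st (suc b) (suc d ∷ rest) st≤)
        (cong (st ++_) (trans (run-push {suc b} {suc d} [] rest (s≤s d<b))
                              (zigzag-pass k z (≤-trans (s≤s (<⇒≤ d<b)) (n≤1+n (suc b)) ∷ n≤1+n (suc b) ∷ []) (s≤s d<b))))
  where
    rest = zigzag (suc (suc b)) (suc (suc d)) k ++ interval (suc (suc (b + k))) z

zigzag-regroup : ∀ b d k z → b ∷ zigzag d (suc b) k ++ interval (suc b + k) z ≡ zigzag b d k ++ interval (b + k) (suc z)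
zigzag-regroup b d zero    z rewrite +-identityʳ b = refl
zigzag-regroup b d (suc k) z rewrite +-suc b k = cong (λ v → b ∷ d ∷ v) (zigzag-regroup (suc b) (suc d) k z)

candidate-pass : ∀ a c k z → 1 ≤ a → s (candidate a (suc c) k z) ≡ candidate a c k (suc z)
candidate-pass a c k z 1≤a = trans (run-interval a c _) (cong (interval a c ++_) middle)
  where
    middle : stackRun [ a + c ] (zigzag (a + suc c) 1 k ++ interval (a + suc c + k) z)
             ≡ zigzag (a + c) 1 k ++ interval (a + c + k) (suc z)
    middle rewrite +-suc a c =
      trans (zigzag-pass k z (n≤1+n (a + c) ∷ []) (≤-trans 1≤a (m≤m+n a c))) (zigzag-regroup (a + c) 1 k z)

candidate-passes : ∀ r a c k z → 1 ≤ a → s^ r (candidate a (r + c) k z) ≡ candidate a c k (r + z)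
candidate-passes zero    a c k z _   = refl
candidate-passes (suc r) a c k z 1≤a = begin
  s (s^ r (candidate a (suc r + c) k z))  ≡⟨ cong (λ v → s (s^ r (candidate a v k z))) (sym (+-suc r c)) ⟩
  s (s^ r (candidate a (r + suc c) k z))  ≡⟨ cong s (candidate-passes r a (suc c) k z 1≤a) ⟩
  s (candidate a (suc c) k (r + z))       ≡⟨ candidate-pass a c k (r + z) 1≤a ⟩
  candidate a c k (suc r + z)             ∎
  where open ≡-Reasoning

des-after-zigzag : ∀ p b d k z → p ≤ b → d < b → des (p ∷ zigzag b d k ++ interval (b + k) z) ≡ k
des-after-zigzag p b d zero z p≤b _ rewrite +-identityʳ b =
  ascending-des (∷-ascending (≤*-interval b z p≤b) (interval-ascending b z))
des-after-zigzag p b d (suc k) z p≤b d<b rewrite +-suc b k =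
  cong₂ _+_ (descent-≤ p≤b)
            (cong₂ _+_ (descent-< d<b) (des-after-zigzag d (suc b) (suc d) k z (≤-trans (<⇒≤ d<b) (n≤1+n b)) (s≤s d<b)))

des-zigzag : ∀ k z → des (candidate (suc k) 0 k z) ≡ k
des-zigzag zero    z = ascending-des (interval-ascending 1 z)
des-zigzag (suc k) z rewrite +-identityʳ k | +-suc k k =
  cong₂ _+_ (descent-< {suc (suc k)} {1} (s≤s (s≤s z≤n))) (des-after-zigzag 1 (suc (suc (suc k))) 2 k z (s≤s z≤n) (s≤s (s≤s (s≤s z≤n))))

zigzag-↭ : ∀ b d k → zigzag b d k ↭ interval d k ++ interval b k
zigzag-↭ b d zero    = ↭-refl
zigzag-↭ b d (suc k) = ↭-trans (swap b d (zigzag-↭ (suc b) (suc d) k))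
                               (prep d (↭-sym (shift b (interval (suc d) k) (interval (suc b) k))))

candidate-↭ : ∀ k t z → candidate (suc k) t k z ↭ interval 1 (k + (t + (k + z)))
candidate-↭ k t z = begin
  I t ++ zigzag (a + t) 1 k ++ Zs                       ↭⟨ ↭-++⁺ˡ (I t) (↭-++⁺ʳ Zs (zigzag-↭ (a + t) 1 k)) ⟩
  I t ++ (interval 1 k ++ interval (a + t) k) ++ Zs    ≡⟨ cong (I t ++_) (++-assoc (interval 1 k) _ Zs) ⟩
  I t ++ interval 1 k ++ interval (a + t) k ++ Zs      ↭⟨ shifts (I t) (interval 1 k) ⟩
  interval 1 k ++ I t ++ interval (a + t) k ++ Zs      ≡⟨ sym split ⟩
  interval 1 (k + (t + (k + z)))                       ∎
  where
    open PermutationReasoning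
    a  = suc k
    I  = interval a
    Zs = interval (a + t + k) z
    split : interval 1 (k + (t + (k + z))) ≡ interval 1 k ++ I t ++ interval (a + t) k ++ Zs
    split = trans (interval-++ 1 k (t + (k + z)))
                  (cong (interval 1 k ++_) (trans (interval-++ a t (k + z)) (cong (I t ++_) (interval-++ (a + t) k z))))

candidate-size : ∀ n t → t ≤ n → (n ∸ t) / 2 + (t + ((n ∸ t) / 2 + (n ∸ t) % 2)) ≡ n
candidate-size n t t≤n = begin
  k + (t + (k + z))  ≡⟨ rearrange k t z ⟩
  t + (z + k * 2)    ≡⟨ cong (t +_) (sym (m≡m%n+[m/n]*n (n ∸ t) 2)) ⟩
  t + (n ∸ t)        ≡⟨ m+[n∸m]≡n t≤n ⟩
  n                  ∎
  where
    open ≡-Reasoning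
    open +-*-Solver
    k = (n ∸ t) / 2
    z = (n ∸ t) % 2
    rearrange : ∀ k t z → k + (t + (k + z)) ≡ t + (z + k * 2)
    rearrange = solve 3 (λ k t z → k :+ (t :+ (k :+ z)) := t :+ (z :+ k :* con 2)) refl

lower-bound : ∀ n t → t ≤ n → Σ (List ℕ) (λ μ → IsPerm n μ × des (s^ t μ) ≡ (n ∸ t) / 2)
lower-bound n t t≤n = μ , is-perm , des-image
  where
    k = (n ∸ t) / 2
    z = (n ∸ t) % 2
    μ = candidate (suc k) t k z
    is-perm : IsPerm n μ
    is-perm = subst (λ m → μ ↭ range1 m) (candidate-size n t t≤n)
                    (subst (μ ↭_) (sym (range1-interval _)) (candidate-↭ k t z))
    des-image : des (s^ t μ) ≡ k
    des-image = begin
      des (s^ t (candidate (suc k) t k z))        ≡⟨ cong (λ c → des (s^ t (candidate (suc k) c k z))) (sym (+-identityʳ t)) ⟩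
      des (s^ t (candidate (suc k) (t + 0) k z))  ≡⟨ cong des (candidate-passes t (suc k) 0 k z (s≤s z≤n)) ⟩
      des (candidate (suc k) 0 k (t + z))         ≡⟨ des-zigzag k (t + z) ⟩
      k                                           ∎
      where open ≡-Reasoning

theorem2 : (n t : ℕ) → 1 ≤ t → t ≤ n →
    (Σ (List ℕ) (λ μ → IsPerm n μ × des (s^ t μ) ≡ (n ∸ t) / 2))
    × ((μ : List ℕ) → IsPerm n μ → des (s^ t μ) ≤ (n ∸ t) / 2)
theorem2 n (suc t) _ t<n = lower-bound n (suc t) t<n , λ μ perm → upper-bound n t μ perm t<n
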